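{- Let $\ell$ be an odd prime, $n>2$, and $\gamma\in\mathrm{GL}_2(\mathbb{Z}/\ell^n\mathbb{Z})$ whose reduction modulo $\ell$ equals $\begin{pmatrix}1&r\\0&1\end{pmatrix}$ with $\ell\nmid r$. If the discriminant $\mathrm{tr}(\gamma)^2-4\det(\gamma)$ is a square modulo $\ell^n$, then $\gamma$ has an eigenvector modulo $\ell^n$, i.e. there is $v\in(\mathbb{Z}/\ell^n\mathbb{Z})^2$, nonzero modulo $\ell$, and $\lambda\in\mathbb{Z}/\ell^n\mathbb{Z}$ with $\gamma v=\lambda v$. -}

module Defs where

open import Data.Nat using (ℕ)
open import Data.Integer using (ℤ; +_; _-_; _+_; _*_)
open import Data.Integer.Divisibility using (_∣_)

-- Congruence of integers modulo a natural number m:  x ≡ y (mod m)  iff  m ∣ x - y.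
-- Elements of ℤ/mℤ are represented by integer representatives up to this relation.
_≡_[mod_] : ℤ → ℤ → ℕ → Set
x ≡ y [mod m ] = (+ m) ∣ (x - y)

infix 4 _≡_[mod_]

-- A 2×2 matrix with entries in ℤ/mℤ, represented by integer entries
--   ( a  b )
--   ( c  d )
record Mat2 : Set where
  constructor mat
  field
    a b c d : ℤ

open Mat2 public

tr : Mat2 → ℤ
tr γ = a γ + d γ

det : Mat2 → ℤ
det γ = a γ * d γ - b γ * c γ

IsGL2 : ℕ → Mat2 → Set
IsGL2 m γ = Data.Product.Σ ℤ (λ u → det γ * u ≡ + 1 [mod m ])
  where import Data.Product

module Submission where

-- Write t = tr γ, D = det γ and P(μ) = μ² - tμ + D for the
-- characteristic polynomial of γ.  Since ℓ is odd, so is N = ℓⁿ, hence 2 has an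
-- inverse h modulo N.  If s² ≡ t² - 4D (mod N), the quadratic formula gives the
-- root μ = h(t + s) of P modulo N; this is the ring identity `root-identity`.
-- For any root μ of P the vector v = (b, μ - a) satisfies γ v ≡ μ v (mod N):
-- the first coordinate holds exactly and the second one differs by -P(μ).
-- Finally b ≡ r (mod ℓ) with ℓ ∤ r, so v is nonzero modulo ℓ.

open import Defs
open import Data.Nat using (ℕ; _>_; _^_)
open import Data.Nat.Primality using (Prime)
open import Data.Integer using (ℤ; +_; _-_; _+_; _*_)
open import Data.Integer.Divisibility using (_∣_)
open import Data.Product using (Σ; _×_)
open import Relation.Nullary using (¬_)
open import Relation.Binary.PropositionalEquality using (_≢_)

import Data.Nat as ℕ
import Data.Nat.Divisibility as ℕ
import Data.Nat.Properties as ℕₚ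
import Data.Nat.Primality as Primality
import Data.Integer as ℤ
import Data.Integer.Properties as ℤₚ
import Data.Integer.Divisibility.Signed as Signed
import Data.Integer.Solver
import Data.Nat.Solver
open import Data.Product using (_,_; proj₁; proj₂)
open import Data.Sum using (_⊎_; inj₁; inj₂)
open import Data.Empty using (⊥-elim)
open import Relation.Binary.PropositionalEquality using (_≡_; refl; sym; trans; cong; subst; module ≡-Reasoning)

Odd : ℕ → Set
Odd m = Σ ℕ (λ k → m ≡ 1 ℕ.+ 2 ℕ.* k)

even-or-odd : ∀ m → Σ ℕ (λ k → m ≡ 2 ℕ.* k) ⊎ Odd m
even-or-odd ℕ.zero = inj₁ (0 , refl)
even-or-odd (ℕ.suc m) with even-or-odd m
... | inj₁ (k , refl) = inj₂ (k , refl)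
... | inj₂ (k , refl) = inj₁ (ℕ.suc k , cong ℕ.suc (sym (ℕₚ.+-suc k (k ℕ.+ 0))))

-- A prime other than 2 is odd: an even prime is divisible by 2, hence equals 2.
odd-prime : ∀ {p} → Prime p → p ≢ 2 → Odd p
odd-prime {p} prime-p p≢2 with even-or-odd p
... | inj₂ odd = odd
... | inj₁ (k , p≡2k) with Primality.prime⇒irreducible prime-p (ℕ.divides k (trans p≡2k (ℕₚ.*-comm 2 k)))
...   | inj₁ ()
...   | inj₂ 2≡p = ⊥-elim (p≢2 (sym 2≡p))

odd-* : ∀ {m n} → Odd m → Odd n → Odd (m ℕ.* n)
odd-* (p , refl) (q , refl) = p ℕ.+ q ℕ.+ 2 ℕ.* p ℕ.* q , expand p q
  where
  open Data.Nat.Solver.+-*-Solver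
  expand : ∀ p q → (1 ℕ.+ 2 ℕ.* p) ℕ.* (1 ℕ.+ 2 ℕ.* q) ≡ 1 ℕ.+ 2 ℕ.* (p ℕ.+ q ℕ.+ 2 ℕ.* p ℕ.* q)
  expand = solve 2 (λ p q → (con 1 :+ con 2 :* p) :* (con 1 :+ con 2 :* q)
                             := con 1 :+ con 2 :* (p :+ q :+ con 2 :* p :* q)) refl

odd-^ : ∀ {m} → Odd m → ∀ n → Odd (m ^ n)
odd-^ odd ℕ.zero    = 0 , refl
odd-^ odd (ℕ.suc n) = odd-* odd (odd-^ odd n)

-- Modulo an odd number N = 1 + 2k, the element h = k + 1 is an inverse of 2,
-- because 2h - 1 = N.  This is what makes the quadratic formula available.
half-mod-odd : ∀ {N} → Odd N → Σ ℤ (λ h → + 2 * h ≡ + 1 [mod N ])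
half-mod-odd {N} (k , N≡1+2k) = h , Signed.∣⇒∣ᵤ (Signed.∣-reflexive (sym 2h-1≡N))
  where
  h : ℤ
  h = + k + + 1
  2h-1≡N : + 2 * h - + 1 ≡ + N
  2h-1≡N = begin
    + 2 * (+ k + + 1) - + 1   ≡⟨ solve 1 (λ k → con (+ 2) :* (k :+ con (+ 1)) :- con (+ 1)
                                          := con (+ 1) :+ con (+ 2) :* k) refl (+ k) ⟩
    + 1 + + 2 * + k           ≡⟨ cong (λ z → + 1 + z) (sym (ℤₚ.pos-* 2 k)) ⟩
    + 1 + + (2 ℕ.* k)         ≡⟨ sym (ℤₚ.pos-+ 1 (2 ℕ.* k)) ⟩
    + (1 ℕ.+ 2 ℕ.* k)         ≡⟨ cong +_ (sym N≡1+2k) ⟩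
    + N                       ∎
    where
    open Data.Integer.Solver.+-*-Solver
    open ≡-Reasoning

≡⇒≡-mod : ∀ {m x y} → x - y ≡ + 0 → x ≡ y [mod m ]
≡⇒≡-mod {m} x-y≡0 = subst (λ z → + m ∣ z) (sym x-y≡0) (m ℕ.∣0)

charPoly : ℤ → ℤ → ℤ → ℤ
charPoly t D μ = μ * μ - t * μ + D

-- The quadratic formula as a polynomial identity: for μ = h(t + s),
--   P(μ) = h²(s² - (t² - 4D)) + (2h - 1)(h(t² + ts) - D(2h + 1)).
-- When 2h ≡ 1 both summands vanish modulo the chosen modulus.
root-identity : ∀ h t D s →
  charPoly t D (h * (t + s)) - + 0
    ≡ h * h * (s * s - (t * t - + 4 * D)) + (+ 2 * h - + 1) * (h * (t * t + t * s) - D * (+ 2 * h + + 1))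
root-identity = solve 4 (λ h t D s →
  (h :* (t :+ s)) :* (h :* (t :+ s)) :- t :* (h :* (t :+ s)) :+ D :- con (+ 0)
    := h :* h :* (s :* s :- (t :* t :- con (+ 4) :* D))
       :+ (con (+ 2) :* h :- con (+ 1)) :* (h :* (t :* t :+ t :* s) :- D :* (con (+ 2) :* h :+ con (+ 1)))) refl
  where open Data.Integer.Solver.+-*-Solver

quadratic-root : ∀ {N} h t D s → + 2 * h ≡ + 1 [mod N ] → s * s ≡ t * t - + 4 * D [mod N ]
  → charPoly t D (h * (t + s)) ≡ + 0 [mod N ]
quadratic-root {N} h t D s 2h≡1 s²≡disc =
  Signed.∣⇒∣ᵤ (subst (Signed._∣_ (+ N)) (sym (root-identity h t D s))
    (Signed.∣m∣n⇒∣m+n (Signed.∣n⇒∣m*n (h * h) (Signed.∣ᵤ⇒∣ {i = s * s - (t * t - + 4 * D)} s²≡disc))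
                      (Signed.∣m⇒∣m*n _ (Signed.∣ᵤ⇒∣ {i = + 2 * h - + 1} 2h≡1))))

-- A root μ of the characteristic polynomial of γ = (a b; c d) yields the
-- eigenvector (b, μ - a): the first coordinate of γv - μv is identically 0 and
-- the second one equals -P(μ).
eigenvector-of-root : ∀ {N} (γ : Mat2) (μ : ℤ) → charPoly (tr γ) (det γ) μ ≡ + 0 [mod N ]
  → (a γ * b γ + b γ * (μ - a γ) ≡ μ * b γ [mod N ])
  × (c γ * b γ + d γ * (μ - a γ) ≡ μ * (μ - a γ) [mod N ])
eigenvector-of-root {N} (mat a b c d) μ root =
    ≡⇒≡-mod {x = a * b + b * (μ - a)} {y = μ * b} (first-coordinate a b μ)
  , Signed.∣⇒∣ᵤ (subst (Signed._∣_ (+ N)) (sym (second-coordinate a b c d μ))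
                                           (Signed.∣m⇒∣-m (Signed.∣ᵤ⇒∣ {i = charPoly (a + d) (a * d - b * c) μ - + 0} root)))
  where
  open Data.Integer.Solver.+-*-Solver
  first-coordinate : ∀ a b μ → a * b + b * (μ - a) - μ * b ≡ + 0
  first-coordinate = solve 3 (λ a b μ → a :* b :+ b :* (μ :- a) :- μ :* b := con (+ 0)) refl
  second-coordinate : ∀ a b c d μ →
    c * b + d * (μ - a) - μ * (μ - a) ≡ ℤ.- (charPoly (a + d) (a * d - b * c) μ - + 0)
  second-coordinate = solve 5 (λ a b c d μ →
    c :* b :+ d :* (μ :- a) :- μ :* (μ :- a)
      := :- (μ :* μ :- (a :+ d) :* μ :+ (a :* d :- b :* c) :- con (+ 0))) refl

≢0-mod : ∀ {m x r} → x ≡ r [mod m ] → ¬ (+ m ∣ r) → ¬ (x ≡ + 0 [mod m ])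
≢0-mod {m} {x} {r} x≡r m∤r x≡0 =
  m∤r (Signed.∣⇒∣ᵤ (subst (Signed._∣_ (+ m)) (sym (r-as-difference x r))
        (Signed.∣m∣n⇒∣m-n (Signed.∣ᵤ⇒∣ {i = x - + 0} x≡0) (Signed.∣ᵤ⇒∣ {i = x - r} x≡r))))
  where
  open Data.Integer.Solver.+-*-Solver
  r-as-difference : ∀ x r → r ≡ (x - + 0) - (x - r)
  r-as-difference = solve 2 (λ x r → r := (x :- con (+ 0)) :- (x :- r)) refl

-- Lemma 4.3.  Only the oddness of ℓⁿ and b ≡ r ≢ 0 (mod ℓ) are needed: the
-- eigenvalue is μ = h(tr γ + s) with h = 1/2 mod ℓⁿ, the eigenvector (b, μ - a).
lemma4p3 : (ℓ n : ℕ) → Prime ℓ → ℓ ≢ 2 → n > 2 → (γ : Mat2) → IsGL2 (ℓ ^ n) γ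
    → (r : ℤ) → a γ ≡ + 1 [mod ℓ ] → b γ ≡ r [mod ℓ ] → c γ ≡ + 0 [mod ℓ ] → d γ ≡ + 1 [mod ℓ ]
    → ¬ ((+ ℓ) ∣ r)
    → Σ ℤ (λ s → s * s ≡ tr γ * tr γ - + 4 * det γ [mod ℓ ^ n ])
    → Σ ℤ (λ x → Σ ℤ (λ y → Σ ℤ (λ μ →
    ¬ ((x ≡ + 0 [mod ℓ ]) × (y ≡ + 0 [mod ℓ ]))
    × (a γ * x + b γ * y ≡ μ * x [mod ℓ ^ n ])
    × (c γ * x + d γ * y ≡ μ * y [mod ℓ ^ n ]))))
lemma4p3 ℓ n prime-ℓ ℓ≢2 _ γ _ r _ b≡r _ _ ℓ∤r (s , s²≡disc) =
  b γ , μ - a γ , μ , b≢0 , eigenvector-of-root γ μ μ-is-root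
  where
  half : Σ ℤ (λ h → + 2 * h ≡ + 1 [mod ℓ ^ n ])
  half = half-mod-odd (odd-^ (odd-prime prime-ℓ ℓ≢2) n)
  μ : ℤ
  μ = proj₁ half * (tr γ + s)
  μ-is-root : charPoly (tr γ) (det γ) μ ≡ + 0 [mod ℓ ^ n ]
  μ-is-root = quadratic-root (proj₁ half) (tr γ) (det γ) s (proj₂ half) s²≡disc
  b≢0 : ¬ ((b γ ≡ + 0 [mod ℓ ]) × (μ - a γ ≡ + 0 [mod ℓ ]))
  b≢0 (b≡0 , _) = ≢0-mod {x = b γ} {r} b≡r ℓ∤r b≡0
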